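{- As $\delta \to 0$, $\mathcal{C}(2, \delta) = \Theta(1/\delta)$; that is, there are absolute constants $c_1, c_2 > 0$ such that $c_1/\delta \le \mathcal{C}(2,\delta) \le c_2/\delta$ for all sufficiently small $\delta > 0$.
   Context: A two-colouring (red/blue) of the edges of $K_n$ is $\delta$-far from being monochromatic if each colour appears on at least $\delta n^2$ edges. An unavoidable $t$-colouring is a two-colouring of the edges of $K_{2t}$ in which the edges of one colour form either a clique on $t$ vertices or two vertex-disjoint cliques on $t$ vertices each, all remaining edges having the other colour; a colouring of $K_n$ contains one if some set of $2t$ vertices induces such a colouring. For $t \in \mathbb{N}$ and $\delta > 0$, $\mathcal{C}(t, \delta)$ denotes the least integer such that for every $n \ge \mathcal{C}(t,\delta)$, every two-colouring of $K_n$ that is $\delta$-far from being monochromatic contains an unavoidable $t$-colouring (this integer is known to exist).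
   Formalization: The parameter δ ranges over the positive rationals. -}

module Defs where

open import Data.Nat using (ℕ; _<_; _≤_; _*_)
open import Data.Nat.Properties using (_<?_)
open import Data.Bool using (Bool; true; false; not; if_then_else_; _∧_)
open import Data.Bool.Properties renaming (_≟_ to _≟ᵇ_) using ()
open import Data.Fin using (Fin; toℕ)
open import Data.List using (List; length; filter; filterᵇ; cartesianProduct; allFin)
open import Data.Product using (_×_; _,_; ∃; ∃-syntax; proj₁; proj₂)
open import Data.Sum using (_⊎_)
open import Relation.Binary.PropositionalEquality using (_≡_; _≢_)
open import Relation.Nullary using (does)
open import Function.Definitions using (Injective)
open import Data.Integer using (+_)
open import Data.Rational as ℚ using (ℚ; _/_)

-- A red/blue two-colouring of the edges of K_n: vertices are Fin n, the colour
-- of edge {u,v} (u ≢ v) is c u v (true = red, false = blue). Diagonal values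
-- are irrelevant; colourings are required to be symmetric.
Colouring : ℕ → Set
Colouring n = Fin n → Fin n → Bool

Symmetric : ∀ {n} → Colouring n → Set
Symmetric c = ∀ u v → c u v ≡ c v u

edges : (n : ℕ) → List (Fin n × Fin n)
edges n = filter (λ p → toℕ (proj₁ p) <? toℕ (proj₂ p)) (cartesianProduct (allFin n) (allFin n))

numEdgesOfColour : ∀ {n} → Colouring n → Bool → ℕ
numEdgesOfColour {n} c b = length (filterᵇ (λ p → does (c (proj₁ p) (proj₂ p) ≟ᵇ b)) (edges n))

ℕtoℚ : ℕ → ℚ
ℕtoℚ m = + m / 1

DeltaFar : ℚ → ∀ {n} → Colouring n → Set
DeltaFar δ {n} c = ∀ (b : Bool) → δ ℚ.* ℕtoℚ (n * n) ℚ.≤ ℕtoℚ (numEdgesOfColour c b)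

-- Vertices of K_{2t} with index < t form the first block A, the rest the block B.
-- Up to relabelling of vertices (handled by the embedding in `Contains`),
-- a set of t vertices in K_{2t} and its complement are these two blocks.
inFirst : (t : ℕ) → Fin (t * 2) → Bool
inFirst t u = does (toℕ u <? t)

-- colour of edge uv in the canonical unavoidable t-colourings, where b is the
-- colour forming the clique(s):
-- type 1: colour b forms a clique on the t vertices of A, all other edges ¬b
oneClique : (t : ℕ) → Bool → Fin (t * 2) → Fin (t * 2) → Bool
oneClique t b u v = if inFirst t u ∧ inFirst t v then b else not b
twoCliques : (t : ℕ) → Bool → Fin (t * 2) → Fin (t * 2) → Bool
twoCliques t b u v = if does (inFirst t u ≟ᵇ inFirst t v) then b else not b

Induces : ∀ {n} (t : ℕ) → Colouring n → (Fin (t * 2) → Fin n) → (Fin (t * 2) → Fin (t * 2) → Bool) → Set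
Induces t c f d = ∀ u v → u ≢ v → c (f u) (f v) ≡ d u v

ContainsUnavoidable : ∀ {n} (t : ℕ) → Colouring n → Set
ContainsUnavoidable {n} t c =
  ∃[ f ] Injective _≡_ _≡_ f × ∃[ b ] (Induces t c f (oneClique t b) ⊎ Induces t c f (twoCliques t b))

Good : ℕ → ℚ → ℕ → Set
Good t δ N = ∀ n → N ≤ n → (c : Colouring n) → Symmetric c → DeltaFar δ c → ContainsUnavoidable t c

IsC : ℕ → ℚ → ℕ → Set
IsC t δ N = Good t δ N × (∀ M → Good t δ M → N ≤ M)

module Submission where

-- An unavoidable 2-colouring on four vertices is exactly an edge xy together with two
-- vertices p, q joined to both x and y in the colour opposite to that of xy (an
-- "unavoidable quad"). A symmetric colouring of K_n, n ≥ 6, without such a quad has a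
-- centre: a vertex v such that all edges avoiding v have one colour β. Indeed, an exhaustive
-- search over K₆ yields a monochromatic K₄ in colour β, at most one vertex is joined to it by
-- an edge of colour ¬β, and that vertex (or any vertex, if there is none) is a centre. So
-- ¬β has at most n - 1 edges, and a δ-far colouring without a quad satisfies δn² ≤ n - 1.
-- Conversely the star, which has no quad, has n - 1 and C(n-1, 2) edges of its two colours.
-- Hence C(2, δ) = m + 1 for the largest m with δm² ≤ m - 1, and δm² ≤ m - 1 < δ(m + 1)²
-- gives 1/(2δ) ≤ m + 1 ≤ 2/δ.

module Combinatorics where

  open import Defs
  open import Data.Nat using (ℕ; zero; suc; _≤_; _<_; _∸_; z≤n; s≤s; z<s; _<ᵇ_)
  open import Data.Nat.Properties using (_<?_; <-asym; <⇒≢; <ᵇ⇒<)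
  open import Data.Bool using (Bool; true; false; not; _∧_; _∨_; _xor_; T; if_then_else_)
  open import Data.Bool.Properties using (∧-comm; ¬-not; not-¬; T-∧; T-∨; T-≡) renaming (_≟_ to _≟ᵇ_)
  open import Data.Fin using (Fin; zero; suc; toℕ; inject≤; punchOut)
  open import Data.Fin.Patterns using (0F; 1F; 2F; 3F)
  open import Data.Fin.Properties
    using (_≟_; any?; all?; ¬∀⟶∃¬; inject≤-injective; suc-injective; punchOut-injective; injective⇒≤)
  open import Data.Vec using (Vec; []; _∷_; tabulate)
  import Data.Vec as Vec
  open import Data.Vec.Properties using (lookup∘tabulate)
  open import Data.Vec.Relation.Unary.All using ([]; _∷_)
  open import Data.Vec.Relation.Unary.AllPairs using ([]; _∷_)
  import Data.Vec.Relation.Unary.Unique.Propositional.Properties as VecUnique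
  open import Data.List using (List; length; lookup; filterᵇ; cartesianProduct; allFin)
  import Data.List.Relation.Unary.All as All
  open import Data.List.Relation.Unary.AllPairs using (_∷_)
  open import Data.List.Relation.Unary.Unique.Propositional using (Unique)
  open import Data.List.Relation.Unary.Unique.Propositional.Properties using (filter⁺; cartesianProduct⁺; allFin⁺)
  open import Data.List.Membership.Propositional using (_∈_)
  open import Data.List.Membership.Propositional.Properties
    using (∈-filter⁺; ∈-filter⁻; ∈-cartesianProduct⁺; ∈-allFin; ∈-lookup)
  open import Data.List.Membership.Setoid.Properties using (index-injective)
  open import Data.Unit using (⊤; tt)
  open import Data.Product using (_×_; _,_; ∃-syntax; proj₁; proj₂)
  open import Data.Sum using (_⊎_; inj₁; inj₂)
  open import Data.Empty using (⊥-elim)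
  open import Function using (_∘_)
  open import Function.Bundles using (Equivalence)
  open import Function.Definitions using (Injective)
  open import Relation.Nullary using (Dec; yes; no; does; ¬_; contradiction)
  open import Relation.Nullary.Decidable using (_×-dec_; _→-dec_; ¬?; from-yes; decidable-stable; dec-true)
  open import Relation.Binary.PropositionalEquality using (_≡_; _≢_; refl; sym; trans; cong; subst; setoid)

  Distinct₄ : ∀ {n} → Fin n → Fin n → Fin n → Fin n → Set
  Distinct₄ x y p q = x ≢ y × x ≢ p × x ≢ q × y ≢ p × y ≢ q × p ≢ q

  Opposite : ∀ {n} → Colouring n → Fin n → Fin n → Fin n → Set
  Opposite c x y p = x ≢ p × y ≢ p × c x p ≢ c x y × c y p ≢ c x y

  -- xy is the clique of the unavoidable colouring and {p, q} its other block; the edge pq may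
  -- have either colour, giving one clique or two.
  UnavoidableQuad : ∀ {n} → Colouring n → Fin n → Fin n → Fin n → Fin n → Set
  UnavoidableQuad c x y p q = x ≢ y × p ≢ q × Opposite c x y p × Opposite c x y q

  HasUnavoidableQuad : ∀ {n} → Colouring n → Set
  HasUnavoidableQuad c = ∃[ x ] ∃[ y ] ∃[ p ] ∃[ q ] UnavoidableQuad c x y p q

  hasUnavoidableQuad? : ∀ {n} (c : Colouring n) → Dec (HasUnavoidableQuad c)
  hasUnavoidableQuad? c = any? λ x → any? λ y → any? λ p → any? λ q →
    ¬? (x ≟ y) ×-dec ¬? (p ≟ q) ×-dec opposite? x y p ×-dec opposite? x y q
    where
    opposite? : ∀ x y p → Dec (Opposite c x y p)
    opposite? x y p = ¬? (x ≟ p) ×-dec ¬? (y ≟ p) ×-dec ¬? (c x p ≟ᵇ c x y) ×-dec ¬? (c y p ≟ᵇ c x y)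

  quad : ∀ {n} → Fin n → Fin n → Fin n → Fin n → Fin 4 → Fin n
  quad x y p q = Vec.lookup (x ∷ y ∷ p ∷ q ∷ [])

  quad-injective : ∀ {n} {x y p q : Fin n} → Distinct₄ x y p q → Injective _≡_ _≡_ (quad x y p q)
  quad-injective (x≢y , x≢p , x≢q , y≢p , y≢q , p≢q) =
    VecUnique.lookup-injective ((x≢y ∷ x≢p ∷ x≢q ∷ []) ∷ (y≢p ∷ y≢q ∷ []) ∷ (p≢q ∷ []) ∷ [] ∷ []) _ _

  oneClique-symmetric : ∀ t b → Symmetric (oneClique t b)
  oneClique-symmetric t b u v = cong (λ z → if z then b else not b) (∧-comm (inFirst t u) (inFirst t v))

  does-≟ᵇ-comm : ∀ a b → does (a ≟ᵇ b) ≡ does (b ≟ᵇ a)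
  does-≟ᵇ-comm false false = refl
  does-≟ᵇ-comm false true = refl
  does-≟ᵇ-comm true false = refl
  does-≟ᵇ-comm true true = refl

  twoCliques-symmetric : ∀ t b → Symmetric (twoCliques t b)
  twoCliques-symmetric t b u v = cong (λ z → if z then b else not b) (does-≟ᵇ-comm (inFirst t u) (inFirst t v))

  module _ {n} {c : Colouring n} (c-sym : Symmetric c) {d : Colouring 4} (d-sym : Symmetric d) {x y p q : Fin n} where

    induces-quad : c x y ≡ d 0F 1F → c x p ≡ d 0F 2F → c x q ≡ d 0F 3F →
                   c y p ≡ d 1F 2F → c y q ≡ d 1F 3F → c p q ≡ d 2F 3F →
                   Induces 2 c (quad x y p q) d
    induces-quad xy xp xq yp yq pq = pairs
      where
      swap-ends : ∀ {u v} i j → c u v ≡ d i j → c v u ≡ d j i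
      swap-ends {u} {v} i j e = trans (c-sym v u) (trans e (d-sym i j))
      pairs : Induces 2 c (quad x y p q) d
      pairs 0F 0F ne = ⊥-elim (ne refl)
      pairs 0F 1F _ = xy
      pairs 0F 2F _ = xp
      pairs 0F 3F _ = xq
      pairs 1F 0F _ = swap-ends 0F 1F xy
      pairs 1F 1F ne = ⊥-elim (ne refl)
      pairs 1F 2F _ = yp
      pairs 1F 3F _ = yq
      pairs 2F 0F _ = swap-ends 0F 2F xp
      pairs 2F 1F _ = swap-ends 1F 2F yp
      pairs 2F 2F ne = ⊥-elim (ne refl)
      pairs 2F 3F _ = pq
      pairs 3F 0F _ = swap-ends 0F 3F xq
      pairs 3F 1F _ = swap-ends 1F 3F yq
      pairs 3F 2F _ = swap-ends 2F 3F pq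
      pairs 3F 3F ne = ⊥-elim (ne refl)

  quad⇒unavoidable : ∀ {n} {c : Colouring n} {x y p q} → Symmetric c → UnavoidableQuad c x y p q →
                     ContainsUnavoidable 2 c
  quad⇒unavoidable {c = c} {x} {y} {p} {q} c-sym (x≢y , p≢q , (x≢p , y≢p , xp , yp) , (x≢q , y≢q , xq , yq))
    with c p q ≟ᵇ c x y
  ... | yes pq = quad x y p q , quad-injective (x≢y , x≢p , x≢q , y≢p , y≢q , p≢q) , c x y ,
    inj₂ (induces-quad c-sym (twoCliques-symmetric 2 (c x y)) refl (¬-not xp) (¬-not xq) (¬-not yp) (¬-not yq) pq)
  ... | no pq = quad x y p q , quad-injective (x≢y , x≢p , x≢q , y≢p , y≢q , p≢q) , c x y ,
    inj₁ (induces-quad c-sym (oneClique-symmetric 2 (c x y)) refl (¬-not xp) (¬-not xq) (¬-not yp) (¬-not yq) (¬-not pq))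

  module _ {n} {c : Colouring n} {f : Fin 4 → Fin n} (f-injective : Injective _≡_ _≡_ f) {d : Colouring 4} {b : Bool}
           (induced : Induces 2 c f d) where

    induced⇒quad : d 0F 1F ≡ b → d 0F 2F ≡ not b → d 1F 2F ≡ not b → d 0F 3F ≡ not b → d 1F 3F ≡ not b →
                   UnavoidableQuad c (f 0F) (f 1F) (f 2F) (f 3F)
    induced⇒quad xy xp yp xq yq =
      distinct (λ ()) , distinct (λ ()) ,
      (distinct (λ ()) , distinct (λ ()) , opposite (λ ()) xp , opposite (λ ()) yp) ,
      (distinct (λ ()) , distinct (λ ()) , opposite (λ ()) xq , opposite (λ ()) yq)
      where
      distinct : ∀ {i j} → i ≢ j → f i ≢ f j
      distinct i≢j fi≡fj = i≢j (f-injective fi≡fj)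
      opposite : ∀ {i j} → i ≢ j → d i j ≡ not b → c (f i) (f j) ≢ c (f 0F) (f 1F)
      opposite {i} {j} i≢j ij e = not-¬ (trans (induced 0F 1F (λ ())) xy) (trans (sym e) (trans (induced i j i≢j) ij))

  unavoidable⇒quad : ∀ {n} {c : Colouring n} → ContainsUnavoidable 2 c → HasUnavoidableQuad c
  unavoidable⇒quad {c = c} (f , f-injective , b , inj₁ induced) =
    _ , _ , _ , _ , induced⇒quad {c = c} f-injective induced refl refl refl refl refl
  unavoidable⇒quad {c = c} (f , f-injective , b , inj₂ induced) =
    _ , _ , _ , _ , induced⇒quad {c = c} f-injective induced refl refl refl refl refl

  star : ∀ {n} → Colouring n
  star zero _ = true
  star (suc _) zero = true
  star (suc _) (suc _) = false

  star-symmetric : ∀ {n} → Symmetric (star {n})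
  star-symmetric zero zero = refl
  star-symmetric zero (suc _) = refl
  star-symmetric (suc _) zero = refl
  star-symmetric (suc _) (suc _) = refl

  star-has-no-quad : ∀ {n} → ¬ HasUnavoidableQuad (star {n})
  star-has-no-quad (zero , _ , _ , _ , _ , _ , (_ , _ , xp , _) , _) = xp refl
  star-has-no-quad (suc _ , zero , _ , _ , _ , _ , (_ , _ , _ , yp) , _) = yp refl
  star-has-no-quad (suc _ , suc _ , suc _ , _ , _ , _ , (_ , _ , xp , _) , _) = xp refl
  star-has-no-quad (suc _ , suc _ , zero , suc _ , _ , _ , _ , (_ , _ , xq , _)) = xq refl
  star-has-no-quad (suc _ , suc _ , zero , zero , _ , p≢q , _) = p≢q refl

  -- A symmetric colouring of K_n is determined by its first row and, recursively, by the rest.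
  Code : ℕ → Set
  Code zero = ⊤
  Code (suc n) = Vec Bool n × Code n

  decode : ∀ {n} → Code n → Colouring n
  decode _ zero zero = false
  decode (row , _) zero (suc j) = Vec.lookup row j
  decode (row , _) (suc i) zero = Vec.lookup row i
  decode (_ , rest) (suc i) (suc j) = decode rest i j

  decode-symmetric : ∀ {n} (x : Code n) → Symmetric (decode x)
  decode-symmetric _ zero zero = refl
  decode-symmetric _ zero (suc j) = refl
  decode-symmetric _ (suc i) zero = refl
  decode-symmetric (_ , rest) (suc i) (suc j) = decode-symmetric rest i j

  encode : ∀ {n} → Colouring n → Code n
  encode {zero} c = tt
  encode {suc n} c = tabulate (λ j → c zero (suc j)) , encode (λ i j → c (suc i) (suc j))

  decode-encode : ∀ {n} {c : Colouring n} → Symmetric c → ∀ i j → i ≢ j → decode (encode c) i j ≡ c i j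
  decode-encode c-sym zero zero i≢j = ⊥-elim (i≢j refl)
  decode-encode c-sym zero (suc j) _ = lookup∘tabulate _ j
  decode-encode c-sym (suc i) zero _ = trans (lookup∘tabulate _ i) (c-sym zero (suc i))
  decode-encode c-sym (suc i) (suc j) i≢j = decode-encode (λ u v → c-sym (suc u) (suc v)) i j (i≢j ∘ cong suc)

  allVectors : ∀ n → (Vec Bool n → Bool) → Bool
  allVectors zero f = f []
  allVectors (suc n) f = allVectors n (f ∘ (true ∷_)) ∧ allVectors n (f ∘ (false ∷_))

  ∧-sound : ∀ {a b} → T (a ∧ b) → T a × T b
  ∧-sound = Equivalence.to T-∧

  allVectors-sound : ∀ n (f : Vec Bool n → Bool) → T (allVectors n f) → ∀ v → T (f v)
  allVectors-sound zero f t [] = t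
  allVectors-sound (suc n) f t (true ∷ v) = allVectors-sound n _ (proj₁ (∧-sound t)) v
  allVectors-sound (suc n) f t (false ∷ v) = allVectors-sound n _ (proj₂ (∧-sound t)) v

  allCodes : ∀ n → (Code n → Bool) → Bool
  allCodes zero f = f tt
  allCodes (suc n) f = allVectors n λ row → allCodes n λ rest → f (row , rest)

  allCodes-sound : ∀ n (f : Code n → Bool) → T (allCodes n f) → ∀ x → T (f x)
  allCodes-sound zero f t tt = t
  allCodes-sound (suc n) f t (row , rest) = allCodes-sound n _ (allVectors-sound n _ t row) rest

  allCodes-≡-sound : ∀ n (f : Code n → Bool) → allCodes n f ≡ true → ∀ x → T (f x)
  allCodes-≡-sound n f = allCodes-sound n f ∘ Equivalence.from T-≡

  anyFin : ∀ {n} → (Fin n → Bool) → Bool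
  anyFin {zero} f = false
  anyFin {suc n} f = f zero ∨ anyFin (f ∘ suc)

  anyFin-sound : ∀ {n} (f : Fin n → Bool) → T (anyFin f) → ∃[ i ] T (f i)
  anyFin-sound {suc n} f t with Equivalence.to (T-∨ {f zero}) t
  ... | inj₁ t₀ = zero , t₀
  ... | inj₂ t₊ with anyFin-sound (f ∘ suc) t₊
  ...   | i , tᵢ = suc i , tᵢ

  T-∨-resolve : ∀ a b → T (a ∨ b) → ¬ T a → T b
  T-∨-resolve true _ _ ¬a = ⊥-elim (¬a _)
  T-∨-resolve false _ b _ = b

  _≠ᵇ_ : ∀ {n} → Fin n → Fin n → Bool
  x ≠ᵇ y = not (does (x ≟ y))

  ≠ᵇ-sound : ∀ {n} {x y : Fin n} → T (x ≠ᵇ y) → x ≢ y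
  ≠ᵇ-sound {x = x} {y} t with x ≟ y
  ... | no x≢y = x≢y

  _<ᶠ_ : ∀ {n} → Fin n → Fin n → Bool
  x <ᶠ y = toℕ x <ᵇ toℕ y

  <ᶠ-sound : ∀ {n} {x y : Fin n} → T (x <ᶠ y) → x ≢ y
  <ᶠ-sound {x = x} {y} t = <⇒≢ (<ᵇ⇒< (toℕ x) (toℕ y) t) ∘ cong toℕ

  xor-sound : ∀ {a b} → T (a xor b) → a ≢ b
  xor-sound {true} {false} _ ()
  xor-sound {false} {true} _ ()

  _==ᵇ_ : Bool → Bool → Bool
  a ==ᵇ b = not (a xor b)

  ==ᵇ-sound : ∀ {a b} → T (a ==ᵇ b) → a ≡ b
  ==ᵇ-sound {true} {true} _ = refl
  ==ᵇ-sound {false} {false} _ = refl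

  oppositeᵇ : ∀ {n} → Colouring n → Fin n → Fin n → Fin n → Bool
  oppositeᵇ c x y p = x ≠ᵇ p ∧ y ≠ᵇ p ∧ (c x p xor c x y) ∧ (c y p xor c x y)

  oppositeᵇ-sound : ∀ {n} {c : Colouring n} {x y p} → T (oppositeᵇ c x y p) → Opposite c x y p
  oppositeᵇ-sound t with ∧-sound t
  ... | x≠p , t₁ with ∧-sound t₁
  ... | y≠p , t₂ with ∧-sound t₂
  ... | xp , yp = ≠ᵇ-sound x≠p , ≠ᵇ-sound y≠p , xor-sound xp , xor-sound yp

  twoOppositesᵇ : ∀ {n} → Colouring n → Fin n → Fin n → Bool
  twoOppositesᵇ c x y = anyFin λ p → oppositeᵇ c x y p ∧ anyFin λ q → p <ᶠ q ∧ oppositeᵇ c x y q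

  twoOppositesᵇ-sound : ∀ {n} {c : Colouring n} {x y} → T (twoOppositesᵇ c x y) →
                        ∃[ p ] ∃[ q ] p ≢ q × Opposite c x y p × Opposite c x y q
  twoOppositesᵇ-sound {c = c} t with anyFin-sound _ t
  ... | p , t₁ with ∧-sound t₁
  ... | xyp , t₂ with anyFin-sound _ t₂
  ... | q , t₃ with ∧-sound t₃
  ... | p<q , xyq = p , q , <ᶠ-sound p<q , oppositeᵇ-sound {c = c} xyp , oppositeᵇ-sound {c = c} xyq

  hasUnavoidableQuadᵇ : ∀ {n} → Colouring n → Bool
  hasUnavoidableQuadᵇ c = anyFin λ x → anyFin λ y → x <ᶠ y ∧ twoOppositesᵇ c x y

  hasUnavoidableQuadᵇ-sound : ∀ {n} {c : Colouring n} → T (hasUnavoidableQuadᵇ c) → HasUnavoidableQuad c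
  hasUnavoidableQuadᵇ-sound {c = c} t with anyFin-sound _ t
  ... | x , t₁ with anyFin-sound _ t₁
  ... | y , t₂ with ∧-sound t₂
  ... | x<y , t₃ with twoOppositesᵇ-sound {c = c} t₃
  ... | p , q , p≢q , xyp , xyq = x , y , p , q , <ᶠ-sound x<y , p≢q , xyp , xyq

  record MonoK4 {n} (c : Colouring n) : Set where
    field
      vertex : Fin 4 → Fin n
      vertex-injective : Injective _≡_ _≡_ vertex
      colour : Bool
      monochromatic : ∀ i j → i ≢ j → c (vertex i) (vertex j) ≡ colour

  Joins : ∀ {n} → Colouring n → Bool → Fin n → Fin n → Fin n → Set
  Joins c b x y p = x ≢ p × y ≢ p × c x p ≡ b × c y p ≡ b

  joinsᵇ : ∀ {n} → Colouring n → Bool → Fin n → Fin n → Fin n → Bool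
  joinsᵇ c b x y p = x ≠ᵇ p ∧ y ≠ᵇ p ∧ (c x p ==ᵇ b) ∧ (c y p ==ᵇ b)

  joinsᵇ-sound : ∀ {n} {c : Colouring n} {b x y p} → T (joinsᵇ c b x y p) → Joins c b x y p
  joinsᵇ-sound t with ∧-sound t
  ... | x≠p , t₁ with ∧-sound t₁
  ... | y≠p , t₂ with ∧-sound t₂
  ... | xp , yp = ≠ᵇ-sound x≠p , ≠ᵇ-sound y≠p , ==ᵇ-sound xp , ==ᵇ-sound yp

  completesK4ᵇ : ∀ {n} → Colouring n → Fin n → Fin n → Bool
  completesK4ᵇ c x y =
    anyFin λ p → joinsᵇ c (c x y) x y p ∧ anyFin λ q → p <ᶠ q ∧ joinsᵇ c (c x y) x y q ∧ (c p q ==ᵇ c x y)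

  completesK4ᵇ-sound : ∀ {n} {c : Colouring n} {x y} → T (completesK4ᵇ c x y) →
                       ∃[ p ] ∃[ q ] p ≢ q × Joins c (c x y) x y p × Joins c (c x y) x y q × c p q ≡ c x y
  completesK4ᵇ-sound {c = c} t with anyFin-sound _ t
  ... | p , t₁ with ∧-sound t₁
  ... | xyp , t₂ with anyFin-sound _ t₂
  ... | q , t₃ with ∧-sound t₃
  ... | p<q , t₄ with ∧-sound t₄
  ... | xyq , pq = p , q , <ᶠ-sound p<q , joinsᵇ-sound {c = c} xyp , joinsᵇ-sound {c = c} xyq , ==ᵇ-sound pq

  hasMonoK4ᵇ : ∀ {n} → Colouring n → Bool
  hasMonoK4ᵇ c = anyFin λ x → anyFin λ y → x <ᶠ y ∧ completesK4ᵇ c x y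

  hasMonoK4ᵇ-sound : ∀ {n} {c : Colouring n} → Symmetric c → T (hasMonoK4ᵇ c) → MonoK4 c
  hasMonoK4ᵇ-sound {c = c} c-sym t with anyFin-sound _ t
  ... | x , t₁ with anyFin-sound _ t₁
  ... | y , t₂ with ∧-sound t₂
  ... | x<y , t₃ with completesK4ᵇ-sound {c = c} t₃
  ... | p , q , p≢q , (x≢p , y≢p , xp , yp) , (x≢q , y≢q , xq , yq) , pq = record
    { vertex = quad x y p q
    ; vertex-injective = quad-injective (<ᶠ-sound x<y , x≢p , x≢q , y≢p , y≢q , p≢q)
    ; colour = c x y
    ; monochromatic = induces-quad c-sym (λ _ _ → refl) refl xp xq yp yq pq
    }

  -- Exhaustive check over all 2¹⁵ symmetric colourings of K₆, run by `refl`. (Proving the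
  -- equivalent `T (allCodes 6 …)` by `tt` instead exhausts the type checker's memory.)
  K₆-quad-or-mono : ∀ x → T (hasUnavoidableQuadᵇ (decode x) ∨ hasMonoK4ᵇ (decode x))
  K₆-quad-or-mono = allCodes-≡-sound 6 (λ x → hasUnavoidableQuadᵇ (decode x) ∨ hasMonoK4ᵇ (decode x)) refl

  K₆-has-mono-K4 : ∀ (x : Code 6) → ¬ HasUnavoidableQuad (decode x) → MonoK4 (decode x)
  K₆-has-mono-K4 x no-quad = hasMonoK4ᵇ-sound (decode-symmetric x)
    (T-∨-resolve (hasUnavoidableQuadᵇ (decode x)) (hasMonoK4ᵇ (decode x)) (K₆-quad-or-mono x)
                 (no-quad ∘ hasUnavoidableQuadᵇ-sound {c = decode x}))

  module _ {m n} {c′ : Colouring m} {c : Colouring n} (e : Fin m → Fin n) (e-injective : Injective _≡_ _≡_ e)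
           (preserves : ∀ i j → i ≢ j → c′ i j ≡ c (e i) (e j)) where

    private
      image-≢ : ∀ {i j} → i ≢ j → e i ≢ e j
      image-≢ i≢j = i≢j ∘ e-injective

      image-opposite : ∀ {x y p} → x ≢ y → Opposite c′ x y p → Opposite c (e x) (e y) (e p)
      image-opposite {x} {y} {p} x≢y (x≢p , y≢p , xp , yp) =
        image-≢ x≢p , image-≢ y≢p , image-colour x≢p xp , image-colour y≢p yp
        where
        image-colour : ∀ {u} → u ≢ p → c′ u p ≢ c′ x y → c (e u) (e p) ≢ c (e x) (e y)
        image-colour {u} u≢p up eq = up (trans (preserves u p u≢p) (trans eq (sym (preserves x y x≢y))))

    hasUnavoidableQuad-image : HasUnavoidableQuad c′ → HasUnavoidableQuad c
    hasUnavoidableQuad-image (x , y , p , q , x≢y , p≢q , xyp , xyq) =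
      e x , e y , e p , e q , image-≢ x≢y , image-≢ p≢q , image-opposite x≢y xyp , image-opposite x≢y xyq

    monoK4-image : MonoK4 c′ → MonoK4 c
    monoK4-image K = record
      { vertex = e ∘ vertex
      ; vertex-injective = vertex-injective ∘ e-injective
      ; colour = colour
      ; monochromatic = λ i j i≢j → trans (sym (preserves _ _ (i≢j ∘ vertex-injective))) (monochromatic i j i≢j)
      }
      where open MonoK4 K

  has-mono-K4 : ∀ {n} {c : Colouring n} → Symmetric c → ¬ HasUnavoidableQuad c → 6 ≤ n → MonoK4 c
  has-mono-K4 {c = c} c-sym no-quad 6≤n =
    monoK4-image e e-injective preserves (K₆-has-mono-K4 code (no-quad ∘ hasUnavoidableQuad-image e e-injective preserves))
    where
    e : Fin 6 → Fin _
    e i = inject≤ i 6≤n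
    e-injective : Injective _≡_ _≡_ e
    e-injective = inject≤-injective _ _ _ _
    code : Code 6
    code = encode (λ i j → c (e i) (e j))
    preserves : ∀ i j → i ≢ j → decode code i j ≡ c (e i) (e j)
    preserves = decode-encode (λ i j → c-sym (e i) (e j))

  avoid-two : ∀ (i j : Fin 4) → ∃[ k ] ∃[ l ] k ≢ l × k ≢ i × k ≢ j × l ≢ i × l ≢ j
  avoid-two = from-yes (all? {n = 4} λ i → all? λ j → any? λ k → any? λ l →
    ¬? (k ≟ l) ×-dec ¬? (k ≟ i) ×-dec ¬? (k ≟ j) ×-dec ¬? (l ≟ i) ×-dec ¬? (l ≟ j))

  AllEdgesAvoiding : ∀ {n} → Colouring n → Fin n → Bool → Set
  AllEdgesAvoiding c v b = ∀ x y → x ≢ v → y ≢ v → x ≢ y → c x y ≡ b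

  module _ {n} {c : Colouring n} (c-sym : Symmetric c) (no-quad : ¬ HasUnavoidableQuad c) (K : MonoK4 c) where

    open MonoK4 K renaming (vertex to s; vertex-injective to s-injective; colour to β)

    Agrees : Fin n → Set
    Agrees w = ∀ k → w ≢ s k → c w (s k) ≡ β

    agrees? : ∀ w → Dec (Agrees w)
    agrees? w = all? λ k → ¬? (w ≟ s k) →-dec (c w (s k) ≟ᵇ β)

    meets-at-most-one : ∀ x → ∃[ i ] ∀ k → k ≢ i → x ≢ s k
    meets-at-most-one x with any? (λ i → x ≟ s i)
    ... | yes (i , x≡sᵢ) = i , λ k k≢i x≡sₖ → k≢i (s-injective (trans (sym x≡sₖ) x≡sᵢ))
    ... | no x∉K = 0F , λ k _ x≡sₖ → x∉K (k , x≡sₖ)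

    agreeing-edge : ∀ {x y} → Agrees x → Agrees y → x ≢ y → c x y ≡ β
    agreeing-edge {x} {y} ax ay x≢y with c x y ≟ᵇ β | meets-at-most-one x | meets-at-most-one y
    ... | yes xy≡β | _ | _ = xy≡β
    ... | no xy≢β | i , x∉ | j , y∉ with avoid-two i j
    ...   | k , l , k≢l , k≢i , k≢j , l≢i , l≢j =
      ⊥-elim (no-quad (x , y , s k , s l , x≢y , k≢l ∘ s-injective , opposite k≢i k≢j , opposite l≢i l≢j))
      where
      opposite : ∀ {m} → m ≢ i → m ≢ j → Opposite c x y (s m)
      opposite m≢i m≢j =
        x∉ _ m≢i , y∉ _ m≢j ,
        (λ eq → xy≢β (trans (sym eq) (ax _ (x∉ _ m≢i)))) , (λ eq → xy≢β (trans (sym eq) (ay _ (y∉ _ m≢j))))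

    disagreeing⇒outside : ∀ {w} → ¬ Agrees w → ∃[ k₀ ] c w (s k₀) ≢ β × ∀ k → w ≢ s k
    disagreeing⇒outside {w} ¬aw with ¬∀⟶∃¬ 4 _ (λ k → ¬? (w ≟ s k) →-dec (c w (s k) ≟ᵇ β)) ¬aw
    ... | k₀ , ¬agrees₀ = k₀ , w₀≢β , outside
      where
      w≢s₀ : w ≢ s k₀
      w≢s₀ eq = ¬agrees₀ (λ w≢ → ⊥-elim (w≢ eq))
      w₀≢β : c w (s k₀) ≢ β
      w₀≢β e = ¬agrees₀ (λ _ → e)
      outside : ∀ k → w ≢ s k
      outside k w≡sₖ =
        w₀≢β (trans (cong (λ z → c z (s k₀)) w≡sₖ)
                    (monochromatic k k₀ (λ k≡k₀ → w≢s₀ (trans w≡sₖ (cong s k≡k₀)))))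

    disagrees-with-all-but-one : ∀ {w} → ¬ Agrees w → ∃[ i ] ∀ k → k ≢ i → w ≢ s k × c w (s k) ≢ β
    disagrees-with-all-but-one {w} ¬aw with disagreeing⇒outside ¬aw | any? (λ i → c w (s i) ≟ᵇ β)
    ... | k₀ , w₀≢β , outside | no none = k₀ , λ k _ → outside k , λ wₖ≡β → none (k , wₖ≡β)
    ... | k₀ , w₀≢β , outside | yes (i , wᵢ≡β) = i , λ k k≢i → outside k , wₖ≢β k k≢i
      where
      opposite : ∀ {m} → m ≢ k₀ → c w (s m) ≡ β → Opposite c w (s k₀) (s m)
      opposite m≢k₀ wₘ≡β =
        outside _ , m≢k₀ ∘ sym ∘ s-injective , (λ eq → w₀≢β (trans (sym eq) wₘ≡β)) ,
        (λ eq → w₀≢β (trans (sym eq) (monochromatic k₀ _ (m≢k₀ ∘ sym))))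
      i≢k₀ : i ≢ k₀
      i≢k₀ i≡k₀ = w₀≢β (subst (λ z → c w (s z) ≡ β) i≡k₀ wᵢ≡β)
      wₖ≢β : ∀ k → k ≢ i → c w (s k) ≢ β
      wₖ≢β k k≢i wₖ≡β with k ≟ k₀
      ... | yes refl = w₀≢β wₖ≡β
      ... | no k≢k₀ = no-quad (w , s k₀ , s i , s k , outside k₀ , k≢i ∘ sym ∘ s-injective ,
                               opposite i≢k₀ wᵢ≡β , opposite k≢k₀ wₖ≡β)

    disagreeing-unique : ∀ {w w′} → ¬ Agrees w → ¬ Agrees w′ → w ≡ w′
    disagreeing-unique {w} {w′} ¬aw ¬aw′
      with w ≟ w′ | disagrees-with-all-but-one ¬aw | disagrees-with-all-but-one ¬aw′
    ... | yes w≡w′ | _ | _ = w≡w′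
    ... | no w≢w′ | i , dw | i′ , dw′ with avoid-two i i′
    ...   | k , l , k≢l , k≢i , k≢i′ , l≢i , l≢i′ =
      ⊥-elim (no-quad (s k , s l , w , w′ , k≢l ∘ s-injective , w≢w′ ,
                       opposite dw k≢i l≢i , opposite dw′ k≢i′ l≢i′))
      where
      opposite : ∀ {u j} → (∀ m → m ≢ j → u ≢ s m × c u (s m) ≢ β) → k ≢ j → l ≢ j →
                 Opposite c (s k) (s l) u
      opposite {u} du k≢j l≢j =
        proj₁ (du k k≢j) ∘ sym , proj₁ (du l l≢j) ∘ sym ,
        (λ eq → proj₂ (du k k≢j) (trans (c-sym u (s k)) (trans eq (monochromatic k l k≢l)))) ,
        (λ eq → proj₂ (du l l≢j) (trans (c-sym u (s l)) (trans eq (monochromatic k l k≢l))))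

    centre : ∃[ v ] AllEdgesAvoiding c v β
    centre with any? (λ w → ¬? (agrees? w))
    ... | yes (v , ¬av) = v , λ x y x≢v y≢v → agreeing-edge (agrees-off x≢v) (agrees-off y≢v)
      where
      agrees-off : ∀ {x} → x ≢ v → Agrees x
      agrees-off {x} x≢v = decidable-stable (agrees? x) (λ ¬ax → x≢v (disagreeing-unique ¬ax ¬av))
    ... | no none-disagree = s 0F , λ x y _ _ → agreeing-edge (agrees x) (agrees y)
      where
      agrees : ∀ x → Agrees x
      agrees x = decidable-stable (agrees? x) (λ ¬ax → none-disagree (x , ¬ax))

  has-centre : ∀ {n} {c : Colouring n} → Symmetric c → ¬ HasUnavoidableQuad c → 6 ≤ n →
               ∃[ b ] ∃[ v ] AllEdgesAvoiding c v b
  has-centre c-sym no-quad 6≤n = MonoK4.colour K , centre c-sym no-quad K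
    where K = has-mono-K4 c-sym no-quad 6≤n

  lookup-injective : ∀ {A : Set} {xs : List A} → Unique xs → ∀ {i j} → lookup xs i ≡ lookup xs j → i ≡ j
  lookup-injective (_ ∷ _) {zero} {zero} _ = refl
  lookup-injective (x∉ ∷ _) {zero} {suc j} eq = contradiction eq (All.lookup x∉ (∈-lookup j))
  lookup-injective (x∉ ∷ _) {suc i} {zero} eq = contradiction (sym eq) (All.lookup x∉ (∈-lookup i))
  lookup-injective (_ ∷ u) {suc i} {suc j} eq = cong suc (lookup-injective u eq)

  unique-length-≤ : ∀ {A : Set} {xs : List A} {m} → Unique xs → (label : ∀ {x} → x ∈ xs → Fin m) →
                    (∀ {x y} (p : x ∈ xs) (q : y ∈ xs) → label p ≡ label q → x ≡ y) → length xs ≤ m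
  unique-length-≤ u label label-injective =
    injective⇒≤ (λ eq → lookup-injective u (label-injective (∈-lookup _) (∈-lookup _) eq))

  T-does : ∀ {A : Set} (a? : Dec A) → A → T (does a?)
  T-does a? a = Equivalence.from T-≡ (dec-true a? a)

  T-does⁻ : ∀ {A : Set} (a? : Dec A) → T (does a?) → A
  T-does⁻ (yes a) _ = a

  Edge : ℕ → Set
  Edge n = Fin n × Fin n

  Ordered : ∀ {n} → Edge n → Set
  Ordered (x , y) = toℕ x < toℕ y

  ColouredEdge : ∀ {n} → Colouring n → Bool → Edge n → Set
  ColouredEdge c b e = Ordered e × c (proj₁ e) (proj₂ e) ≡ b

  colouredEdges : ∀ {n} → Colouring n → Bool → List (Edge n)
  colouredEdges {n} c b = filterᵇ (λ p → does (c (proj₁ p) (proj₂ p) ≟ᵇ b)) (edges n)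

  module _ {n} (c : Colouring n) (b : Bool) where

    ∈-colouredEdges⁺ : ∀ {e} → ColouredEdge c b e → e ∈ colouredEdges c b
    ∈-colouredEdges⁺ {x , y} (x<y , xy≡b) =
      ∈-filter⁺ _ (∈-filter⁺ _ (∈-cartesianProduct⁺ (∈-allFin x) (∈-allFin y)) x<y) (T-does (c x y ≟ᵇ b) xy≡b)

    ∈-colouredEdges⁻ : ∀ {e} → e ∈ colouredEdges c b → ColouredEdge c b e
    ∈-colouredEdges⁻ {x , y} p with ∈-filter⁻ _ {xs = edges n} p
    ... | q , t =
      proj₂ (∈-filter⁻ (λ e → toℕ (proj₁ e) <? toℕ (proj₂ e)) {xs = cartesianProduct (allFin n) (allFin n)} q) ,
      T-does⁻ (c x y ≟ᵇ b) t

    colouredEdges-unique : Unique (colouredEdges c b)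
    colouredEdges-unique = filter⁺ _ (filter⁺ _ (cartesianProduct⁺ (allFin⁺ n) (allFin⁺ n)))

    ≤-numEdgesOfColour : ∀ {k} (g : Fin k → Edge n) → Injective _≡_ _≡_ g → (∀ i → ColouredEdge c b (g i)) →
                         k ≤ numEdgesOfColour c b
    ≤-numEdgesOfColour g g-injective coloured =
      injective⇒≤ λ eq →
        g-injective (index-injective (setoid (Edge n)) (∈-colouredEdges⁺ (coloured _)) (∈-colouredEdges⁺ (coloured _)) eq)

  through-unique : ∀ {n} {v w : Fin n} {e e′ : Edge n} → Ordered e → Ordered e′ →
                   e ≡ (v , w) ⊎ e ≡ (w , v) → e′ ≡ (v , w) ⊎ e′ ≡ (w , v) → e ≡ e′
  through-unique _ _ (inj₁ refl) (inj₁ refl) = refl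
  through-unique _ _ (inj₂ refl) (inj₂ refl) = refl
  through-unique v<w w<v (inj₁ refl) (inj₂ refl) = ⊥-elim (<-asym v<w w<v)
  through-unique w<v v<w (inj₂ refl) (inj₁ refl) = ⊥-elim (<-asym v<w w<v)

  numEdgesOfColour-≤ : ∀ {n} (c : Colouring n) (b : Bool) (v : Fin n) →
                       (∀ {x y} → x ≢ v → y ≢ v → x ≢ y → c x y ≢ b) → numEdgesOfColour c b ≤ n ∸ 1
  numEdgesOfColour-≤ {suc n} c b v avoid = unique-length-≤ (colouredEdges-unique c b) label label-injective
    where
    OtherEnd : Edge (suc n) → Set
    OtherEnd e = ∃[ w ] v ≢ w × (e ≡ (v , w) ⊎ e ≡ (w , v))

    other-end : ∀ e → ColouredEdge c b e → OtherEnd e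
    other-end (x , y) (x<y , xy≡b) with x ≟ v | y ≟ v
    ... | yes refl | _ = y , <⇒≢ x<y ∘ cong toℕ , inj₁ refl
    ... | no x≢v | yes refl = x , x≢v ∘ sym , inj₂ refl
    ... | no x≢v | no y≢v = ⊥-elim (avoid x≢v y≢v (<⇒≢ x<y ∘ cong toℕ) xy≡b)

    end : ∀ {e} → OtherEnd e → Fin n
    end (w , v≢w , _) = punchOut v≢w

    end-injective : ∀ {e e′} → Ordered e → Ordered e′ → (r : OtherEnd e) (r′ : OtherEnd e′) →
                    end r ≡ end r′ → e ≡ e′
    end-injective o o′ (w , v≢w , e≡) (w′ , v≢w′ , e′≡) eq with punchOut-injective v≢w v≢w′ eq
    ... | refl = through-unique o o′ e≡ e′≡

    label : ∀ {e} → e ∈ colouredEdges c b → Fin n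
    label p = end (other-end _ (∈-colouredEdges⁻ c b p))

    label-injective : ∀ {e e′} (p : e ∈ colouredEdges c b) (q : e′ ∈ colouredEdges c b) →
                      label p ≡ label q → e ≡ e′
    label-injective p q =
      end-injective (proj₁ (∈-colouredEdges⁻ c b p)) (proj₁ (∈-colouredEdges⁻ c b q))
                    (other-end _ (∈-colouredEdges⁻ c b p)) (other-end _ (∈-colouredEdges⁻ c b q))

  star-red-edges : ∀ k → k ≤ numEdgesOfColour (star {suc k}) true
  star-red-edges k = ≤-numEdgesOfColour star true (λ j → zero , suc j) (suc-injective ∘ cong proj₂) (λ _ → z<s , refl)

  star-blue-edges : ∀ k → suc (suc (suc k)) ≤ numEdgesOfColour (star {suc (suc (suc (suc k)))}) false
  star-blue-edges k = ≤-numEdgesOfColour star false g g-injective coloured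
    where
    g : Fin (suc (suc (suc k))) → Edge (suc (suc (suc (suc k))))
    g zero = suc (suc zero) , suc (suc (suc zero))
    g (suc j) = suc zero , suc (suc j)
    g-injective : Injective _≡_ _≡_ g
    g-injective {zero} {zero} _ = refl
    g-injective {zero} {suc _} eq with cong proj₁ eq
    ... | ()
    g-injective {suc _} {zero} eq with cong proj₁ eq
    ... | ()
    g-injective {suc _} {suc _} eq = cong suc (suc-injective (suc-injective (cong proj₂ eq)))
    coloured : ∀ i → ColouredEdge star false (g i)
    coloured zero = s≤s (s≤s (s≤s z≤n)) , refl
    coloured (suc j) = s≤s (s≤s z≤n) , refl

  star-edges : ∀ {m} → 4 ≤ m → ∀ b → m ∸ 1 ≤ numEdgesOfColour (star {m}) b
  star-edges {suc (suc (suc (suc k)))} (s≤s (s≤s (s≤s (s≤s _)))) true = star-red-edges (suc (suc (suc k)))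
  star-edges {suc (suc (suc (suc k)))} (s≤s (s≤s (s≤s (s≤s _)))) false = star-blue-edges k

module Bounds where

  open import Defs
  open Combinatorics
  open import Data.Nat using (ℕ; zero; suc; _+_; _*_; _∸_; _≤_; _<_; _≤?_; z≤n; s≤s; z<s; s≤s⁻¹)
  open import Data.Nat.Properties
  open import Data.Nat.Coprimality using (Coprime)
  open import Data.Nat.Tactic.RingSolver using (solve-∀)
  open import Data.Bool using (not)
  open import Data.Bool.Properties using (not-¬)
  open import Data.Integer as ℤ using (+_; +[1+_])
  import Data.Integer.Properties as ℤP
  open import Data.Rational as ℚ using (ℚ; mkℚ; toℚᵘ)
  import Data.Rational.Properties as ℚP
  open import Data.Rational.Unnormalised as ℚᵘ using (ℚᵘ; mkℚᵘ; *≤*; _≃_)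
  import Data.Rational.Unnormalised.Properties as ℚᵘP
  open import Data.Product using (_×_; _,_; ∃-syntax; proj₁; proj₂)
  open import Data.Empty using (⊥-elim)
  open import Relation.Nullary using (Dec; yes; no; ¬_)
  open import Relation.Unary using (Decidable)
  open import Relation.Binary.PropositionalEquality using (_≡_; _≢_; refl; sym; trans; cong; subst; subst₂)
  open ≤-Reasoning

  greatest : ∀ {P : ℕ → Set} → Decidable P → ∀ {a} B → P a → a ≤ B → (∀ k → B < k → ¬ P k) →
             ∃[ m ] a ≤ m × P m × ∀ k → m < k → ¬ P k
  greatest P? B pa a≤B beyond with P? B
  ... | yes pB = B , a≤B , pB , beyond
  greatest P? zero pa z≤n beyond | no ¬p₀ = ⊥-elim (¬p₀ pa)
  greatest {P} P? (suc B) pa a≤1+B beyond | no ¬p =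
    greatest P? B pa (s≤s⁻¹ (≤∧≢⇒< a≤1+B λ { refl → ¬p pa })) beyond′
    where
    beyond′ : ∀ k → B < k → ¬ P k
    beyond′ k B<k with suc B ≟ k
    ... | yes refl = ¬p
    ... | no 1+B≢k = beyond k (≤∧≢⇒< B<k 1+B≢k)

  ℕtoℚ-≃ : ∀ a → toℚᵘ (ℕtoℚ a) ≃ mkℚᵘ (+ a) 0
  ℕtoℚ-≃ a = ℚP.toℚᵘ-fromℚᵘ (mkℚᵘ (+ a) 0)

  ℕtoℚ-mono : ∀ {a b} → a ≤ b → ℕtoℚ a ℚ.≤ ℕtoℚ b
  ℕtoℚ-mono {a} {b} a≤b =
    ℚP.toℚᵘ-cancel-≤ (ℚᵘP.≤-respʳ-≃ (ℚᵘP.≃-sym (ℕtoℚ-≃ b)) (ℚᵘP.≤-respˡ-≃ (ℚᵘP.≃-sym (ℕtoℚ-≃ a))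
    (*≤* (subst₂ ℤ._≤_ (sym (ℤP.*-identityʳ _)) (sym (ℤP.*-identityʳ _)) (ℤ.+≤+ a≤b)))))

  -- mkℚ stores the denominator minus one: δ = (1 + p) / (1 + D).
  module PositiveRational (p D : ℕ) .(cop : Coprime (suc p) (suc D)) where

    δ : ℚ
    δ = mkℚ +[1+ p ] D cop

    private
      scaled-≃ : ∀ a → toℚᵘ (δ ℚ.* ℕtoℚ a) ≃ mkℚᵘ +[1+ p ] D ℚᵘ.* mkℚᵘ (+ a) 0
      scaled-≃ a = ℚᵘP.≃-trans (ℚP.toℚᵘ-homo-* δ (ℕtoℚ a)) (ℚᵘP.*-congˡ {mkℚᵘ +[1+ p ] D} (ℕtoℚ-≃ a))

      lhs : ∀ a b → ℚᵘ.numerator (mkℚᵘ +[1+ p ] D ℚᵘ.* mkℚᵘ (+ a) 0) ℤ.* ℚᵘ.denominator (mkℚᵘ (+ b) 0) ≡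
                    + (suc p * a)
      lhs a b = trans (ℤP.*-identityʳ _) (sym (ℤP.pos-* (suc p) a))

      rhs : ∀ a b → + b ℤ.* ℚᵘ.denominator (mkℚᵘ +[1+ p ] D ℚᵘ.* mkℚᵘ (+ a) 0) ≡ + (suc D * b)
      rhs a b = trans (cong (+ b ℤ.*_) (cong +_ (*-identityʳ (suc D))))
                      (trans (sym (ℤP.pos-* b (suc D))) (cong +_ (*-comm b (suc D))))

    scaled-≤⇒ : ∀ a b → δ ℚ.* ℕtoℚ a ℚ.≤ ℕtoℚ b → suc p * a ≤ suc D * b
    scaled-≤⇒ a b le with ℚᵘP.≤-respʳ-≃ (ℕtoℚ-≃ b) (ℚᵘP.≤-respˡ-≃ (scaled-≃ a) (ℚP.toℚᵘ-mono-≤ le))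
    ... | *≤* le′ = ℤP.drop‿+≤+ (subst₂ ℤ._≤_ (lhs a b) (rhs a b) le′)

    scaled-≤⇐ : ∀ a b → suc p * a ≤ suc D * b → δ ℚ.* ℕtoℚ a ℚ.≤ ℕtoℚ b
    scaled-≤⇐ a b le =
      ℚP.toℚᵘ-cancel-≤ (ℚᵘP.≤-respʳ-≃ (ℚᵘP.≃-sym (ℕtoℚ-≃ b)) (ℚᵘP.≤-respˡ-≃ (ℚᵘP.≃-sym (scaled-≃ a))
      (*≤* (subst₂ ℤ._≤_ (sym (lhs a b)) (sym (rhs a b)) (ℤ.+≤+ le)))))

    instance
      δ-nonZero : ℚ.NonZero δ
      δ-nonZero = _

    ½÷δ-≤ : ∀ N → suc D ≤ 2 * suc p * N → ℚ.½ ℚ.÷ δ ℚ.≤ ℕtoℚ N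
    ½÷δ-≤ N le = ℚP.toℚᵘ-cancel-≤ (ℚᵘP.≤-respʳ-≃ (ℚᵘP.≃-sym (ℕtoℚ-≃ N))
      (ℚᵘP.≤-respˡ-≃ (ℚᵘP.≃-sym (ℚP.toℚᵘ-homo-* ℚ.½ (ℚ.1/ δ))) (*≤* (subst₂ ℤ._≤_ lhs′ rhs′ (ℤ.+≤+ le)))))
      where
      lhs′ : + suc D ≡ ℚᵘ.numerator (mkℚᵘ (+ 1) 1 ℚᵘ.* mkℚᵘ +[1+ D ] p) ℤ.* ℚᵘ.denominator (mkℚᵘ (+ N) 0)
      lhs′ = sym (trans (ℤP.*-identityʳ _) (ℤP.*-identityˡ _))
      rhs′ : + (2 * suc p * N) ≡ + N ℤ.* ℚᵘ.denominator (mkℚᵘ (+ 1) 1 ℚᵘ.* mkℚᵘ +[1+ D ] p)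
      rhs′ = trans (cong +_ (*-comm (2 * suc p) N)) (ℤP.pos-* N (2 * suc p))

    ≤-2÷δ : ∀ N → N * suc p ≤ 2 * suc D → ℕtoℚ N ℚ.≤ ℕtoℚ 2 ℚ.÷ δ
    ≤-2÷δ N le = ℚP.toℚᵘ-cancel-≤ (ℚᵘP.≤-respˡ-≃ (ℚᵘP.≃-sym (ℕtoℚ-≃ N))
      (ℚᵘP.≤-respʳ-≃ (ℚᵘP.≃-sym (ℚP.toℚᵘ-homo-* (ℕtoℚ 2) (ℚ.1/ δ))) (*≤* (subst₂ ℤ._≤_ lhs′ rhs′ (ℤ.+≤+ le)))))
      where
      lhs′ : + (N * suc p) ≡ + N ℤ.* ℚᵘ.denominator (mkℚᵘ (+ 2) 0 ℚᵘ.* mkℚᵘ +[1+ D ] p)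
      lhs′ = trans (cong +_ (cong (N *_) (sym (+-identityʳ (suc p))))) (ℤP.pos-* N _)
      rhs′ : + (2 * suc D) ≡ ℚᵘ.numerator (mkℚᵘ (+ 2) 0 ℚᵘ.* mkℚᵘ +[1+ D ] p) ℤ.* ℚᵘ.denominator (mkℚᵘ (+ N) 0)
      rhs′ = sym (trans (ℤP.*-identityʳ _) (sym (ℤP.pos-* 2 (suc D))))

    <⅛⇒ : δ ℚ.< + 1 ℚ./ 8 → 8 * suc p < suc D
    <⅛⇒ lt = ℤP.drop‿+<+ (subst₂ ℤ._<_ lhs′ (ℤP.*-identityˡ _) (ℚP.drop-*<* lt))
      where
      lhs′ : +[1+ p ] ℤ.* + 8 ≡ + (8 * suc p)
      lhs′ = trans (sym (ℤP.pos-* (suc p) 8)) (cong +_ (*-comm (suc p) 8))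

  module Threshold (p D : ℕ) .(cop : Coprime (suc p) (suc D)) (8P<Q : 8 * suc p < suc D) where

    open PositiveRational p D cop

    P Q : ℕ
    P = suc p
    Q = suc D

    -- δk² ≤ k - 1 for δ = P / Q; for k ≥ 4 it says that the star on k vertices is δ-far.
    StarFar : ℕ → Set
    StarFar k = P * (k * k) ≤ Q * (k ∸ 1)

    P≤Q : P ≤ Q
    P≤Q = ≤-trans (m≤n*m P 8) (<⇒≤ 8P<Q)

    starFar-6 : StarFar 6
    starFar-6 = begin
      P * 36     ≤⟨ *-monoʳ-≤ P (m≤m+n 36 4) ⟩
      P * 40     ≡⟨ regroup P ⟩
      8 * P * 5  ≤⟨ *-monoˡ-≤ 5 (<⇒≤ 8P<Q) ⟩
      Q * 5      ∎
      where
      regroup : ∀ x → x * 40 ≡ 8 * x * 5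
      regroup = solve-∀

    ¬starFar-beyond : ∀ k → Q < k → ¬ StarFar k
    ¬starFar-beyond k@(suc _) Q<k = <⇒≱ (begin-strict
      Q * (k ∸ 1)  ≤⟨ *-monoʳ-≤ Q (m∸n≤m k 1) ⟩
      Q * k        <⟨ *-monoˡ-< k Q<k ⟩
      k * k        ≤⟨ m≤n*m (k * k) P ⟩
      P * (k * k)  ∎)

    -- m is the largest k with δk² ≤ k - 1, and C(2, δ) = m + 1. It is kept abstract: unfolding it
    -- makes the type checker run the search symbolically on the bound Q.
    abstract
      private
        greatest-starFar : ∃[ m ] 6 ≤ m × StarFar m × ∀ k → m < k → ¬ StarFar k
        greatest-starFar = greatest (λ k → P * (k * k) ≤? Q * (k ∸ 1)) Q starFar-6 6≤Q ¬starFar-beyond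
          where
          6≤Q : 6 ≤ Q
          6≤Q = ≤-trans (m≤m+n 6 2) (≤-trans (m≤m*n 8 P) (<⇒≤ 8P<Q))

      m : ℕ
      m = proj₁ greatest-starFar

      6≤m : 6 ≤ m
      6≤m = proj₁ (proj₂ greatest-starFar)

      starFar-m : StarFar m
      starFar-m = proj₁ (proj₂ (proj₂ greatest-starFar))

      m-maximal : ∀ k → m < k → ¬ StarFar k
      m-maximal = proj₂ (proj₂ (proj₂ greatest-starFar))

    1+m*P≤2Q : suc m * P ≤ 2 * Q
    1+m*P≤2Q = subst (suc m * P ≤_) (sym (cong (_+_ Q) (+-identityʳ Q))) (+-mono-≤ P≤Q (<⇒≤ m*P<Q))
      where
      m*P<Q : m * P < Q
      m*P<Q with Q ≤? m * P
      ... | no Q≰m*P = ≰⇒> Q≰m*P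
      ... | yes Q≤m*P = ⊥-elim (<⇒≱ (begin-strict
        Q * (m ∸ 1)  <⟨ *-monoʳ-< Q (m∸1<m) ⟩
        Q * m        ≤⟨ *-monoˡ-≤ m Q≤m*P ⟩
        m * P * m    ≡⟨ regroup m P ⟩
        P * (m * m)  ∎) starFar-m)
        where
        m∸1<m : m ∸ 1 < m
        m∸1<m = ∸-monoʳ-< {m} {1} {0} z<s (≤-trans (s≤s z≤n) 6≤m)
        regroup : ∀ a b → a * b * a ≡ b * (a * a)
        regroup = solve-∀

    Q≤2P*[1+m] : Q ≤ 2 * P * suc m
    Q≤2P*[1+m] with Q ≤? 2 * P * suc m
    ... | yes Q≤ = Q≤
    ... | no Q≰ = ⊥-elim (m-maximal (suc m) (n<1+n m) (begin
      P * (suc m * suc m)    ≤⟨ *-monoʳ-≤ P (*-monoʳ-≤ (suc m) 1+m≤2m) ⟩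
      P * (suc m * (2 * m))  ≡⟨ regroup P (suc m) m ⟩
      2 * P * suc m * m      ≤⟨ *-monoˡ-≤ m (<⇒≤ (≰⇒> Q≰)) ⟩
      Q * m                  ∎))
      where
      1+m≤2m : suc m ≤ 2 * m
      1+m≤2m = begin
        suc m   ≡⟨ +-comm 1 m ⟩
        m + 1   ≤⟨ +-monoʳ-≤ m (≤-trans (s≤s z≤n) 6≤m) ⟩
        m + m   ≡⟨ cong (_+_ m) (sym (+-identityʳ m)) ⟩
        2 * m   ∎
      regroup : ∀ a b c → a * (b * (2 * c)) ≡ 2 * a * b * c
      regroup = solve-∀

    far⇒starFar : ∀ {n} {c : Colouring n} {b} → DeltaFar δ c → numEdgesOfColour c b ≤ n ∸ 1 → StarFar n
    far⇒starFar {n} {b = b} far few = scaled-≤⇒ (n * n) (n ∸ 1) (ℚP.≤-trans (far b) (ℕtoℚ-mono few))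

    starFar⇒far : ∀ {k} → 4 ≤ k → StarFar k → DeltaFar δ (star {k})
    starFar⇒far {k} 4≤k sf b = ℚP.≤-trans (scaled-≤⇐ (k * k) (k ∸ 1) sf) (ℕtoℚ-mono (star-edges 4≤k b))

    good : Good 2 δ (suc m)
    good n m<n c c-sym far = quad-or-sparse (hasUnavoidableQuad? c)
      where
      sparse : (∃[ β ] ∃[ v ] AllEdgesAvoiding c v β) → StarFar n
      sparse (β , v , avoid) =
        far⇒starFar {c = c} {b = not β} far (numEdgesOfColour-≤ c (not β) v λ x≢v y≢v x≢y → not-¬ (avoid _ _ x≢v y≢v x≢y))
      quad-or-sparse : Dec (HasUnavoidableQuad c) → ContainsUnavoidable 2 c
      quad-or-sparse (yes (_ , _ , _ , _ , quad)) = quad⇒unavoidable c-sym quad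
      quad-or-sparse (no no-quad) = ⊥-elim (m-maximal n m<n (sparse (has-centre c-sym no-quad (≤-trans 6≤m (<⇒≤ m<n)))))

    least : ∀ M → Good 2 δ M → suc m ≤ M
    least M good-M = ≮⇒≥ λ M≤m → star-has-no-quad (unavoidable⇒quad
      (good-M m (s≤s⁻¹ M≤m) star star-symmetric (starFar⇒far (≤-trans (m≤m+n 4 2) 6≤m) starFar-m)))

    isC : IsC 2 δ (suc m)
    isC = good , least

open Bounds using (module PositiveRational; module Threshold)
open import Defs
open import Data.Nat using (suc; z≤n; s≤s)
open import Data.Integer using (+_; +[1+_]; -[1+_]; +<+)
open import Data.Integer.Base using (Positive)
open import Data.Empty using (⊥-elim)
import Data.Rational as ℚ
open import Data.Product using (_×_; _,_; ∃; ∃-syntax)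
open import Data.Rational using (ℚ; 0ℚ; _<_; _≤_; _÷_; positive)
open import Data.Rational.Properties using (pos⇒nonZero)

proposition5p1 :
    ∃[ c₁ ] ∃[ c₂ ] ∃[ δ₀ ] (0ℚ < c₁ × 0ℚ < c₂ × 0ℚ < δ₀ ×
      (∀ (δ : ℚ) (δ>0 : 0ℚ < δ) → δ < δ₀ →
        ∃[ N ] (IsC 2 δ N ×
          ((c₁ ÷ δ) {{pos⇒nonZero δ {{positive δ>0}}}} ≤ ℕtoℚ N ×
           ℕtoℚ N ≤ (c₂ ÷ δ) {{pos⇒nonZero δ {{positive δ>0}}}}))))
proposition5p1 =
  ℚ.½ , ℕtoℚ 2 , + 1 ℚ./ 8 , ℚ.*<* (+<+ (s≤s z≤n)) , ℚ.*<* (+<+ (s≤s z≤n)) , ℚ.*<* (+<+ (s≤s z≤n)) , bounds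
  where
  bounds : ∀ (δ : ℚ) (δ>0 : 0ℚ < δ) → δ < + 1 ℚ./ 8 →
           ∃[ N ] (IsC 2 δ N × (ℚ.½ ÷ δ) {{pos⇒nonZero δ {{positive δ>0}}}} ≤ ℕtoℚ N ×
                                ℕtoℚ N ≤ (ℕtoℚ 2 ÷ δ) {{pos⇒nonZero δ {{positive δ>0}}}})
  bounds (ℚ.mkℚ +[1+ p ] D cop) _ δ<⅛ = suc m , isC , ½÷δ-≤ (suc m) Q≤2P*[1+m] , ≤-2÷δ (suc m) 1+m*P≤2Q
    where
    open PositiveRational p D cop
    open Threshold p D cop (<⅛⇒ δ<⅛)
  bounds (ℚ.mkℚ (+ 0) _ _) δ>0 _ = ⊥-elim (Positive.pos (positive δ>0))
  bounds (ℚ.mkℚ -[1+ _ ] _ _) δ>0 _ = ⊥-elim (Positive.pos (positive δ>0))
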